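{- Let $G$ be a $\mathbb{Z}_2$-vertex magic graph. Then $spec(G,\mathbb{Z}_2)$ is a subgroup of $\mathbb{Z}_2$ if and only if $G$ is Eulerian. In this case $spec(G,\mathbb{Z}_2)=\{0\}$.
   Context: All graphs are finite, simple and connected; a graph is Eulerian if every vertex has even degree. For an additive abelian group $A$ with identity $0$ and a graph $G$, an $A$-vertex magic labeling of $G$ is a map $l:V(G)\to A\setminus\{0\}$ for which there is $\mu\in A$ (the magic constant) such that $w(v):=\sum_{u\in N_G(v)} l(u)=\mu$ for every $v\in V(G)$. $G$ is $A$-vertex magic if such a labeling exists. $spec(G,A)$ denotes the set of all magic constants of $A$-vertex magic labelings of $G$. -}

module Defs where

open import Data.Nat using (ℕ; zero; suc)
open import Data.Nat.Divisibility using (_∣_)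
open import Data.Fin using (Fin)
import Data.Fin as F
open import Data.Bool using (Bool; true; false; if_then_else_)
open import Data.Product using (Σ; _×_; ∃)
open import Relation.Binary.PropositionalEquality using (_≡_)
open import Relation.Nullary using (¬_)

data ℤ₂ : Set where
  𝟘 𝟙 : ℤ₂

_⊕_ : ℤ₂ → ℤ₂ → ℤ₂
𝟘 ⊕ y = y
𝟙 ⊕ 𝟘 = 𝟙
𝟙 ⊕ 𝟙 = 𝟘

⊖_ : ℤ₂ → ℤ₂
⊖ x = x

Σ₂ : (n : ℕ) → (Fin n → ℤ₂) → ℤ₂
Σ₂ zero    f = 𝟘
Σ₂ (suc n) f = f F.zero ⊕ Σ₂ n (λ i → f (F.suc i))

count : (n : ℕ) → (Fin n → Bool) → ℕ
count zero    p = 0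
count (suc n) p = (if p F.zero then 1 else 0) Data.Nat.+ count n (λ i → p (F.suc i))
  where import Data.Nat

record Graph : Set where
  field
    n     : ℕ
    adj   : Fin n → Fin n → Bool
    sym   : ∀ u v → adj u v ≡ adj v u
    irrefl : ∀ v → adj v v ≡ false

open Graph public

data Reachable (G : Graph) : Fin (n G) → Fin (n G) → Set where
  here : ∀ {v} → Reachable G v v
  step : ∀ {u v w} → adj G u v ≡ true → Reachable G v w → Reachable G u w

Connected : Graph → Set
Connected G = ∀ u v → Reachable G u v

degree : (G : Graph) → Fin (n G) → ℕ
degree G v = count (n G) (adj G v)

Eulerian : Graph → Set
Eulerian G = ∀ v → 2 ∣ degree G v

weight : (G : Graph) → (Fin (n G) → ℤ₂) → Fin (n G) → ℤ₂
weight G l v = Σ₂ (n G) (λ u → if adj G v u then l u else 𝟘)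

IsMagicLabeling : (G : Graph) → (Fin (n G) → ℤ₂) → ℤ₂ → Set
IsMagicLabeling G l μ = (∀ v → ¬ (l v ≡ 𝟘)) × (∀ v → weight G l v ≡ μ)

VertexMagic : Graph → Set
VertexMagic G = Σ (Fin (n G) → ℤ₂) λ l → ∃ λ μ → IsMagicLabeling G l μ

spec : Graph → ℤ₂ → Set
spec G μ = Σ (Fin (n G) → ℤ₂) λ l → IsMagicLabeling G l μ

IsSubgroup : (ℤ₂ → Set) → Set
IsSubgroup S = S 𝟘 × (∀ x y → S x → S y → S (x ⊕ y)) × (∀ x → S x → S (⊖ x))

-- In ℤ₂ the only nonzero label is 𝟙, so every ℤ₂-vertex magic labeling is the
-- all-one labeling, and the weight of a vertex is the parity of its degree. Hence
-- 𝟘 ∈ spec G exactly when G is Eulerian, and then spec G = {𝟘}; otherwise spec G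
-- misses 𝟘 and is no subgroup.
module Submission where

open import Defs hiding (sym)
open import Data.Nat using (ℕ; zero; suc; _≤_)
open import Data.Nat.Divisibility using (_∣_; _∣0; ∣-refl; ∣1⇒≡1; ∣m∣n⇒∣m+n; ∣m+n∣m⇒∣n)
open import Data.Fin using (Fin; fromℕ<)
import Data.Fin as F
open import Data.Bool using (Bool; true; false; if_then_else_)
open import Data.Product using (_×_; _,_; proj₁)
open import Function using (_∘_)
open import Function.Bundles using (_⇔_; mk⇔; Equivalence)
open import Relation.Binary.PropositionalEquality using (_≡_; _≢_; refl; sym; trans; cong₂)
open import Relation.Nullary using (contradiction)

open Equivalence using (to; from)

parity : ℕ → ℤ₂
parity zero    = 𝟘
parity (suc m) = 𝟙 ⊕ parity m

𝟙⊕𝟙⊕x≡x : ∀ x → 𝟙 ⊕ (𝟙 ⊕ x) ≡ x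
𝟙⊕𝟙⊕x≡x 𝟘 = refl
𝟙⊕𝟙⊕x≡x 𝟙 = refl

x≢𝟘⇒x≡𝟙 : ∀ {x} → x ≢ 𝟘 → x ≡ 𝟙
x≢𝟘⇒x≡𝟙 {𝟘} x≢𝟘 = contradiction refl x≢𝟘
x≢𝟘⇒x≡𝟙 {𝟙} _   = refl

parity≡𝟘⇔2∣ : ∀ d → parity d ≡ 𝟘 ⇔ 2 ∣ d
parity≡𝟘⇔2∣ d = mk⇔ (parity≡𝟘⇒2∣ d) (2∣⇒parity≡𝟘 d)
  where
  parity≡𝟘⇒2∣ : ∀ d → parity d ≡ 𝟘 → 2 ∣ d
  parity≡𝟘⇒2∣ zero          _ = 2 ∣0
  parity≡𝟘⇒2∣ (suc zero)    ()
  parity≡𝟘⇒2∣ (suc (suc d)) p =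
    ∣m∣n⇒∣m+n ∣-refl (parity≡𝟘⇒2∣ d (trans (sym (𝟙⊕𝟙⊕x≡x (parity d))) p))

  2∣⇒parity≡𝟘 : ∀ d → 2 ∣ d → parity d ≡ 𝟘
  2∣⇒parity≡𝟘 zero          _   = refl
  2∣⇒parity≡𝟘 (suc zero)    2∣1 = contradiction (∣1⇒≡1 2∣1) λ ()
  2∣⇒parity≡𝟘 (suc (suc d)) 2∣d+2 =
    trans (𝟙⊕𝟙⊕x≡x (parity d)) (2∣⇒parity≡𝟘 d (∣m+n∣m⇒∣n 2∣d+2 ∣-refl))

Σ₂-selected-ones≡parity-count : ∀ n (p : Fin n → Bool) (l : Fin n → ℤ₂) → (∀ u → l u ≡ 𝟙) →
  Σ₂ n (λ u → if p u then l u else 𝟘) ≡ parity (count n p)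
Σ₂-selected-ones≡parity-count zero    p l l≡𝟙 = refl
Σ₂-selected-ones≡parity-count (suc n) p l l≡𝟙
  with p F.zero | Σ₂-selected-ones≡parity-count n (p ∘ F.suc) (l ∘ F.suc) (l≡𝟙 ∘ F.suc)
... | true  | rest = cong₂ _⊕_ (l≡𝟙 F.zero) rest
... | false | rest = rest

weight≡parity-degree : (G : Graph) (l : Fin (n G) → ℤ₂) → (∀ v → l v ≢ 𝟘) →
  ∀ v → weight G l v ≡ parity (degree G v)
weight≡parity-degree G l l≢𝟘 v =
  Σ₂-selected-ones≡parity-count (n G) (adj G v) l (λ u → x≢𝟘⇒x≡𝟙 (l≢𝟘 u))

spec⇔parity-degree≡ : (G : Graph) (μ : ℤ₂) → spec G μ ⇔ (∀ v → parity (degree G v) ≡ μ)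
spec⇔parity-degree≡ G μ = mk⇔ constant-parity all-one-magic
  where
  constant-parity : spec G μ → ∀ v → parity (degree G v) ≡ μ
  constant-parity (l , l≢𝟘 , weight≡μ) v = trans (sym (weight≡parity-degree G l l≢𝟘 v)) (weight≡μ v)

  all-one-magic : (∀ v → parity (degree G v) ≡ μ) → spec G μ
  all-one-magic parity≡μ =
    (λ _ → 𝟙) , (λ _ ()) , λ v → trans (weight≡parity-degree G (λ _ → 𝟙) (λ _ ()) v) (parity≡μ v)

𝟘∈spec⇔Eulerian : (G : Graph) → spec G 𝟘 ⇔ Eulerian G
𝟘∈spec⇔Eulerian G = mk⇔
  (λ 𝟘∈spec v → to (parity≡𝟘⇔2∣ _) (to (spec⇔parity-degree≡ G 𝟘) 𝟘∈spec v))
  (λ eulerian → from (spec⇔parity-degree≡ G 𝟘) λ v → from (parity≡𝟘⇔2∣ _) (eulerian v))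

Eulerian⇒spec≡｛𝟘｝ : (G : Graph) → 1 ≤ n G → Eulerian G → ∀ μ → spec G μ ⇔ μ ≡ 𝟘
Eulerian⇒spec≡｛𝟘｝ G 1≤n eulerian μ = mk⇔ μ≡𝟘 λ { refl → from (𝟘∈spec⇔Eulerian G) eulerian }
  where
  μ≡𝟘 : spec G μ → μ ≡ 𝟘
  μ≡𝟘 μ∈spec = let v = fromℕ< 1≤n in
    trans (sym (to (spec⇔parity-degree≡ G μ) μ∈spec v)) (from (parity≡𝟘⇔2∣ _) (eulerian v))

｛𝟘｝-isSubgroup : (S : ℤ₂ → Set) → (∀ μ → S μ ⇔ μ ≡ 𝟘) → IsSubgroup S
｛𝟘｝-isSubgroup S S≡｛𝟘｝ = 𝟘∈S , ⊕-closed , λ _ x∈S → x∈S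
  where
  𝟘∈S : S 𝟘
  𝟘∈S = from (S≡｛𝟘｝ 𝟘) refl

  ⊕-closed : ∀ x y → S x → S y → S (x ⊕ y)
  ⊕-closed x y x∈S y∈S with to (S≡｛𝟘｝ x) x∈S | to (S≡｛𝟘｝ y) y∈S
  ... | refl | refl = 𝟘∈S

mainTheorem4 : (G : Graph) → 1 ≤ n G → Connected G → VertexMagic G →
    (IsSubgroup (spec G) ⇔ Eulerian G) × (Eulerian G → ∀ μ → spec G μ ⇔ μ ≡ 𝟘)
mainTheorem4 G 1≤n _ _ =
  mk⇔ (λ subgroup → to (𝟘∈spec⇔Eulerian G) (proj₁ subgroup))
      (λ eulerian → ｛𝟘｝-isSubgroup (spec G) (Eulerian⇒spec≡｛𝟘｝ G 1≤n eulerian)) ,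
  Eulerian⇒spec≡｛𝟘｝ G 1≤n
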